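{- Let $S$ be a semigroup having exactly $n$ minimal left ideals $I_{i_1},\dots,I_{i_n}$ (with $n$ a positive integer). Then the clique number $\omega(\mathcal{I}n(S))$ equals $n$ if and only if $I_{i_1}\cup I_{i_2}\cup\cdots\cup I_{i_n}$ is a maximal left ideal of $S$.
   Context: A left ideal of a semigroup $S$ is a non-empty subset $I$ with $SI\subseteq I$; it is nontrivial if $I\neq S$, minimal if it properly contains no left ideal of $S$, and (when nontrivial) maximal if it is not properly contained in any nontrivial left ideal of $S$. The inclusion ideal graph $\mathcal{I}n(S)$ is the simple undirected graph whose vertices are the nontrivial left ideals of $S$, with distinct $I,J$ adjacent iff $I\subset J$ or $J\subset I$. The clique number is the maximum size of a set of pairwise adjacent vertices. -}

module Defs where

open import Level using (Level; _⊔_; suc)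
open import Algebra.Bundles using (Semigroup)
open import Data.Nat using (ℕ; _≤_)
open import Data.Fin using (Fin)
open import Data.Product using (Σ; ∃; _×_)
open import Data.Sum using (_⊎_)
open import Relation.Nullary using (¬_)
open import Relation.Binary.PropositionalEquality using (_≡_; _≢_)
open import Relation.Unary using (Pred; _∈_; _⊆_)

module _ {c ℓ : Level} (S : Semigroup c ℓ) (p : Level) where
  open Semigroup S

  Subset : Set (c ⊔ suc p)
  Subset = Pred Carrier p

  _⊂_ : Subset → Subset → Set (c ⊔ p)
  I ⊂ J = (I ⊆ J) × ¬ (J ⊆ I)

  record IsLeftIdeal (I : Subset) : Set (c ⊔ ℓ ⊔ p) where
    field
      respects : ∀ {x y} → x ≈ y → x ∈ I → y ∈ I
      nonEmpty : ∃ λ x → x ∈ I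
      leftClosed : ∀ s {x} → x ∈ I → (s ∙ x) ∈ I

  NonTrivial : Subset → Set (c ⊔ p)
  NonTrivial I = ¬ (∀ x → x ∈ I)

  IsMinimalLeftIdeal : Subset → Set (c ⊔ ℓ ⊔ suc p)
  IsMinimalLeftIdeal I = IsLeftIdeal I × (∀ J → IsLeftIdeal J → ¬ (J ⊂ I))

  IsMaximalLeftIdeal : Subset → Set (c ⊔ ℓ ⊔ suc p)
  IsMaximalLeftIdeal I =
    IsLeftIdeal I × NonTrivial I ×
    (∀ J → IsLeftIdeal J → NonTrivial J → ¬ (I ⊂ J))

  IsVertex : Subset → Set (c ⊔ ℓ ⊔ p)
  IsVertex I = IsLeftIdeal I × NonTrivial I

  -- a clique of size k in In(S): k vertices, pairwise adjacent
  -- (distinct indices give properly comparable, hence distinct, ideals)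
  HasClique : ℕ → Set (c ⊔ ℓ ⊔ suc p)
  HasClique k = Σ (Fin k → Subset) λ V →
    (∀ i → IsVertex (V i)) ×
    (∀ i j → i ≢ j → (V i ⊂ V j) ⊎ (V j ⊂ V i))

  CliqueNumberIs : ℕ → Set (c ⊔ ℓ ⊔ suc p)
  CliqueNumberIs n = HasClique n × (∀ k → HasClique k → k ≤ n)

  _≐_ : Subset → Subset → Set (c ⊔ p)
  I ≐ J = (I ⊆ J) × (J ⊆ I)

  ExactlyMinimalLeftIdeals : (n : ℕ) → (Fin n → Subset) → Set (c ⊔ ℓ ⊔ suc p)
  ExactlyMinimalLeftIdeals n M =
    (∀ i → IsMinimalLeftIdeal (M i)) ×
    (∀ i j → i ≢ j → ¬ (M i ≐ M j)) ×
    (∀ J → IsMinimalLeftIdeal J → ∃ λ i → J ≐ M i)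

  ⋃ : (n : ℕ) → (Fin n → Subset) → Subset
  ⋃ n M x = ∃ λ i → x ∈ M i

-- Rank every vertex V of In(S) by the number of minimal left ideals it contains.  A left ideal
-- meeting a minimal one contains it, so along a chain of vertices this rank strictly increases as
-- long as the larger ideal lies in ⋃M or is covered by the smaller one together with ⋃M.  If ⋃M = S
-- the ranks of vertices lie in 1..n-1, so no clique has n members; if ⋃M is properly contained in a
-- vertex J, then J above the chain M₁ ⊂ M₁ ∪ M₂ ⊂ ⋯ ⊂ ⋃M is a clique with n + 1 members.
-- Conversely, if ⋃M is maximal then every vertex V lies in ⋃M or satisfies V ∪ ⋃M = S, and adding
-- one to the rank in the second case ranks all vertices of a clique injectively into 1..n.
-- The arguments are classical, so they run under double negation, which is harmless since the
-- conclusions (inequalities between naturals, negations) are stable.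
module Submission where

open import Defs
open import Level using (Level)
open import Algebra.Bundles using (Semigroup)
open import Data.Nat using (ℕ; NonZero)
open import Data.Fin using (Fin)
open import Function.Bundles using (_⇔_)

open import Data.Nat using (zero; suc; pred; _≤_; _<_; _≤?_; z≤n; s≤s; >-nonZero)
open import Data.Nat.Properties
  using ( ≤-refl; ≤-trans; <⇒≤; ≤-<-trans; <-≤-trans; <⇒≢; <⇒≱; ≤∧≢⇒<; <⇒≤pred
        ; m≤pred[n]⇒suc[m]≤n; pred-injective; 1+n≰n)
open import Data.Fin using (zero; suc; _≟_)
import Data.Fin.Base as Fin
open import Data.Fin.Properties using (injective⇒≤; fromℕ<-injective; <-cmp; sequence)
import Data.Fin.Subset as Fs
open import Data.Fin.Subset.Properties
  using (_∈?_; _⊂?_; drop-there; ∈⊤; ∣p∣≤n; ∣p∣≡n⇒p≡⊤; p⊆q⇒∣p∣≤∣q∣; p⊂q⇒∣p∣<∣q∣; x∈p⇒∣p-x∣<∣p∣)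
open import Data.Vec using ([]; _∷_; here; there)
import Data.Vec.Functional as Vector
open import Data.Product using (Σ; _×_; _,_; proj₁; proj₂)
import Data.Product as Product
open import Data.Sum using (_⊎_; inj₁; inj₂; [_,_])
import Data.Sum as Sum
open import Level using (_⊔_)
open import Effect.Monad using (RawMonad)
open import Function using (_∘_; const; id)
open import Function.Bundles using (mk⇔; Equivalence)
open Equivalence using (to; from)
open import Function.Definitions using (Injective)
open import Relation.Binary using (tri<; tri≈; tri>)
open import Relation.Binary.PropositionalEquality using (_≡_; _≢_; refl; sym; cong; subst)
open import Relation.Nullary using (¬_; yes; no; does; contradiction)
open import Relation.Nullary.Decidable using (decidable-stable; ¬¬-excluded-middle)
open import Relation.Nullary.Negation using (¬¬-Monad)
open import Relation.Unary using (Pred; Decidable; _∈_; _⊆_; _⊈_; _∪_; _∩_)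
  renaming (_⊂_ to _⊊_; ⋃ to ⋃ᵤ)

private
  variable
    a : Level
    n : ℕ

¬¬-sequence : {P : Pred (Fin n) a} → (∀ i → ¬ ¬ P i) → ¬ ¬ (∀ i → P i)
¬¬-sequence = sequence (RawMonad.rawApplicative ¬¬-Monad)

¬¬-decidable : (P : Pred (Fin n) a) → ¬ ¬ Decidable P
¬¬-decidable P = ¬¬-sequence (λ _ → ¬¬-excluded-middle)

toSubset : {P : Pred (Fin n) a} → Decidable P → Fs.Subset n
toSubset {n = zero}  P? = []
toSubset {n = suc n} P? = does (P? zero) ∷ toSubset (P? ∘ suc)

∈-toSubset : {P : Pred (Fin n) a} (P? : Decidable P) (j : Fin n) → j Fs.∈ toSubset P? ⇔ P j
∈-toSubset P? zero with P? zero
... | yes P₀ = mk⇔ (const P₀) (const here)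
... | no ¬P₀ = mk⇔ (λ ()) (λ P₀ → contradiction P₀ ¬P₀)
∈-toSubset P? (suc j) =
  mk⇔ (to (∈-toSubset (P? ∘ suc) j) ∘ drop-there) (there ∘ from (∈-toSubset (P? ∘ suc) j))

p⊆q∧q⊈p⇒∣p∣<∣q∣ : {p q : Fs.Subset n} → p Fs.⊆ q → ¬ (q Fs.⊆ p) → Fs.∣ p ∣ < Fs.∣ q ∣
p⊆q∧q⊈p⇒∣p∣<∣q∣ {p = p} {q} p⊆q q⊈p = p⊂q⇒∣p∣<∣q∣ (decidable-stable (p ⊂? q) λ p⊄q →
  q⊈p λ {x} x∈q → decidable-stable (x ∈? p) λ x∉p → p⊄q (p⊆q , x , x∈q , x∉p))

x∈p⇒0<∣p∣ : {p : Fs.Subset n} {x : Fin n} → x Fs.∈ p → 0 < Fs.∣ p ∣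
x∈p⇒0<∣p∣ x∈p = ≤-<-trans z≤n (x∈p⇒∣p-x∣<∣p∣ x∈p)

nonfull⇒∣p∣<n : {p : Fs.Subset n} → ¬ (∀ x → x Fs.∈ p) → Fs.∣ p ∣ < n
nonfull⇒∣p∣<n {p = p} nonfull = ≤∧≢⇒< (∣p∣≤n p) λ ∣p∣≡n →
  nonfull λ x → subst (x Fs.∈_) (sym (∣p∣≡n⇒p≡⊤ ∣p∣≡n)) ∈⊤

positive-injection⇒≤ : {k N : ℕ} (f : Fin k → ℕ) → Injective _≡_ _≡_ f →
  (∀ i → 0 < f i) → (∀ i → f i ≤ N) → k ≤ N
positive-injection⇒≤ {N = N} f f-injective f-positive f-bounded = injective⇒≤ λ {i} {j} eq →
  f-injective (pred-injective {{>-nonZero (f-positive i)}} {{>-nonZero (f-positive j)}}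
    (fromℕ<-injective _ _ (pred<N i) (pred<N j) eq))
  where
  pred<N : ∀ i → pred (f i) < N
  pred<N i = <-≤-trans (m≤pred[n]⇒suc[m]≤n {{>-nonZero (f-positive i)}} ≤-refl) (f-bounded i)

chain-length≤ : ∀ {r} {A : Set a} {_≺_ : A → A → Set r} {k N : ℕ} (V : Fin k → A) →
  (∀ i j → i ≢ j → V i ≺ V j ⊎ V j ≺ V i) →
  (rank : Fin k → ℕ) → (∀ i j → V i ≺ V j → rank i < rank j) →
  (∀ i → 0 < rank i) → (∀ i → rank i ≤ N) → k ≤ N
chain-length≤ V comparable rank rank-mono = positive-injection⇒≤ rank rank-injective
  where
  rank-injective : Injective _≡_ _≡_ rank
  rank-injective {i} {j} rᵢ≡rⱼ = decidable-stable (i ≟ j) λ i≢j →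
    [ (λ Vi≺Vj → <⇒≢ (rank-mono i j Vi≺Vj) rᵢ≡rⱼ)
    , (λ Vj≺Vi → <⇒≢ (rank-mono j i Vj≺Vi) (sym rᵢ≡rⱼ)) ] (comparable i j i≢j)

module _ {c ℓ} {S : Semigroup c ℓ} {p : Level} where
  open Semigroup S using (Carrier)
  open IsLeftIdeal

  ∩-isLeftIdeal : {I J : Subset S p} {x : Carrier} → IsLeftIdeal S p I → IsLeftIdeal S p J →
    x ∈ I → x ∈ J → IsLeftIdeal S p (I ∩ J)
  ∩-isLeftIdeal I-ideal J-ideal x∈I x∈J = record
    { respects = λ x≈y (x∈I , x∈J) → respects I-ideal x≈y x∈I , respects J-ideal x≈y x∈J
    ; nonEmpty = _ , x∈I , x∈J
    ; leftClosed = λ s (x∈I , x∈J) → leftClosed I-ideal s x∈I , leftClosed J-ideal s x∈J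
    }

  ∪-isLeftIdeal : {I J : Subset S p} → IsLeftIdeal S p I → IsLeftIdeal S p J → IsLeftIdeal S p (I ∪ J)
  ∪-isLeftIdeal I-ideal J-ideal = record
    { respects = λ x≈y → Sum.map (respects I-ideal x≈y) (respects J-ideal x≈y)
    ; nonEmpty = Product.map₂ inj₁ (nonEmpty I-ideal)
    ; leftClosed = λ s → Sum.map (leftClosed I-ideal s) (leftClosed J-ideal s)
    }

  ⋃-isLeftIdeal : {Ix : Set} (F : Ix → Subset S p) → Ix → (∀ i → IsLeftIdeal S p (F i)) →
    IsLeftIdeal S p (⋃ᵤ Ix F)
  ⋃-isLeftIdeal F i F-ideal = record
    { respects = λ x≈y (j , x∈Fj) → j , respects (F-ideal j) x≈y x∈Fj
    ; nonEmpty = Product.map₂ (i ,_) (nonEmpty (F-ideal i))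
    ; leftClosed = λ s (j , x∈Fj) → j , leftClosed (F-ideal j) s x∈Fj
    }

  ⊆-nonTrivial : {I J : Subset S p} → I ⊆ J → NonTrivial S p J → NonTrivial S p I
  ⊆-nonTrivial I⊆J J≠S I=S = J≠S (I⊆J ∘ I=S)

  minimal⇒¬¬⊆ : {L I : Subset S p} {x : Carrier} → IsMinimalLeftIdeal S p L → IsLeftIdeal S p I →
    x ∈ L → x ∈ I → ¬ ¬ (L ⊆ I)
  minimal⇒¬¬⊆ (L-ideal , L-minimal) I-ideal x∈L x∈I L⊈I =
    L-minimal _ (∩-isLeftIdeal L-ideal I-ideal x∈L x∈I) (proj₁ , λ L⊆L∩I → L⊈I (proj₂ ∘ L⊆L∩I))

  IsClique : {k : ℕ} → (Fin k → Subset S p) → Set (c ⊔ ℓ ⊔ p)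
  IsClique V = (∀ i → IsVertex S p (V i)) × (∀ i j → i ≢ j → V i ⊊ V j ⊎ V j ⊊ V i)

  ∷-isClique : {k : ℕ} {J : Subset S p} {V : Fin k → Subset S p} → IsVertex S p J →
    (∀ i → V i ⊊ J) → IsClique V → IsClique (J Vector.∷ V)
  ∷-isClique {k} {J} {V} J-vertex V⊊J (V-vertex , V-comparable) = vertex , comparable
    where
    J∷V : Fin (suc k) → Subset S p
    J∷V = J Vector.∷ V
    vertex : ∀ i → IsVertex S p (J∷V i)
    vertex zero = J-vertex
    vertex (suc i) = V-vertex i
    comparable : ∀ i j → i ≢ j → J∷V i ⊊ J∷V j ⊎ J∷V j ⊊ J∷V i
    comparable zero zero 0≢0 = contradiction refl 0≢0
    comparable zero (suc j) _ = inj₂ (V⊊J j)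
    comparable (suc i) zero _ = inj₁ (V⊊J i)
    comparable (suc i) (suc j) i+1≢j+1 = V-comparable i j (i+1≢j+1 ∘ cong suc)

module MinimalLeftIdeals {c ℓ} {S : Semigroup c ℓ} {p : Level} {n : ℕ} {M : Fin n → Subset S p}
  (minimals : ExactlyMinimalLeftIdeals S p n M) where

  open Semigroup S using (Carrier)
  open IsLeftIdeal

  M-minimal : ∀ l → IsMinimalLeftIdeal S p (M l)
  M-minimal = proj₁ minimals

  M-isLeftIdeal : ∀ l → IsLeftIdeal S p (M l)
  M-isLeftIdeal = proj₁ ∘ M-minimal

  M-disjoint : ∀ {i j x} → x ∈ M i → x ∈ M j → i ≡ j
  M-disjoint {i} {j} x∈Mi x∈Mj = decidable-stable (i ≟ j) λ i≢j →
    minimal⇒¬¬⊆ (M-minimal i) (M-isLeftIdeal j) x∈Mi x∈Mj λ Mi⊆Mj →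
    minimal⇒¬¬⊆ (M-minimal j) (M-isLeftIdeal i) x∈Mj x∈Mi λ Mj⊆Mi →
    proj₁ (proj₂ minimals) i j i≢j (Mi⊆Mj , Mj⊆Mi)

  ⋃M : Subset S p
  ⋃M = ⋃ S p n M

  ⋃M-isLeftIdeal : Fin n → IsLeftIdeal S p ⋃M
  ⋃M-isLeftIdeal i = ⋃-isLeftIdeal M i M-isLeftIdeal

  Contains : Subset S p → Pred (Fin n) (c ⊔ p)
  Contains V l = M l ⊆ V

  size : {V : Subset S p} → Decidable (Contains V) → ℕ
  size V? = Fs.∣ toSubset V? ∣

  meets⇒∈toSubset : {V : Subset S p} {x : Carrier} {l : Fin n} (V? : Decidable (Contains V)) →
    IsLeftIdeal S p V → x ∈ V → x ∈ M l → l Fs.∈ toSubset V?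
  meets⇒∈toSubset {l = l} V? V-ideal x∈V x∈Ml = from (∈-toSubset V? l)
    (decidable-stable (V? l) (minimal⇒¬¬⊆ (M-minimal l) V-ideal x∈Ml x∈V))

  module _ {V W : Subset S p} (V? : Decidable (Contains V)) (W? : Decidable (Contains W)) where

    toSubset-mono : V ⊆ W → toSubset V? Fs.⊆ toSubset W?
    toSubset-mono V⊆W {l} l∈V = from (∈-toSubset W? l) (V⊆W ∘ to (∈-toSubset V? l) l∈V)

    size-mono : V ⊆ W → size V? ≤ size W?
    size-mono = p⊆q⇒∣p∣≤∣q∣ ∘ toSubset-mono

    size-strictMono : IsLeftIdeal S p W → V ⊊ W → W ⊆ V ∪ ⋃M → size V? < size W?
    size-strictMono W-ideal (V⊆W , W⊈V) W⊆V∪⋃M = p⊆q∧q⊈p⇒∣p∣<∣q∣ (toSubset-mono V⊆W) λ Wₛ⊆Vₛ →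
      W⊈V λ x∈W → [ id , (λ (l , x∈Ml) → to (∈-toSubset V? l)
        (Wₛ⊆Vₛ (meets⇒∈toSubset W? W-ideal x∈W x∈Ml)) x∈Ml) ] (W⊆V∪⋃M x∈W)

  size-positive : {V : Subset S p} {x : Carrier} (V? : Decidable (Contains V)) → IsLeftIdeal S p V →
    x ∈ V → x ∈ ⋃M → 0 < size V?
  size-positive V? V-ideal x∈V (l , x∈Ml) = x∈p⇒0<∣p∣ (meets⇒∈toSubset V? V-ideal x∈V x∈Ml)

  size<n : {V : Subset S p} (V? : Decidable (Contains V)) → ⋃M ⊈ V → size V? < n
  size<n V? ⋃M⊈V = nonfull⇒∣p∣<n λ full → ⋃M⊈V λ (l , x∈Ml) → to (∈-toSubset V? l) (full l) x∈Ml

  initialUnion : Fin n → Subset S p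
  initialUnion i = ⋃ᵤ (Σ (Fin n) (Fin._≤ i)) (M ∘ proj₁)

  initialUnion⊆⋃M : ∀ i → initialUnion i ⊆ ⋃M
  initialUnion⊆⋃M i ((l , _) , x∈Ml) = l , x∈Ml

  initialUnion-strictMono : ∀ {i j} → i Fin.< j → initialUnion i ⊊ initialUnion j
  initialUnion-strictMono {i} {j} i<j =
    (λ ((l , l≤i) , x∈Ml) → (l , ≤-trans l≤i (<⇒≤ i<j)) , x∈Ml) ,
    λ Uⱼ⊆Uᵢ → let (x , x∈Mj) = nonEmpty (M-isLeftIdeal j)
                  ((l , l≤i) , x∈Ml) = Uⱼ⊆Uᵢ ((j , ≤-refl) , x∈Mj)
              in <⇒≱ i<j (subst (Fin._≤ i) (M-disjoint x∈Ml x∈Mj) l≤i)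

  initialUnions-isClique : NonTrivial S p ⋃M → IsClique initialUnion
  initialUnions-isClique ⋃M≠S = vertex , comparable
    where
    vertex : ∀ i → IsVertex S p (initialUnion i)
    vertex i = ⋃-isLeftIdeal (M ∘ proj₁) (i , ≤-refl) (M-isLeftIdeal ∘ proj₁) ,
               ⊆-nonTrivial {S = S} (initialUnion⊆⋃M i) ⋃M≠S
    comparable : ∀ i j → i ≢ j → initialUnion i ⊊ initialUnion j ⊎ initialUnion j ⊊ initialUnion i
    comparable i j i≢j with <-cmp i j
    ... | tri< i<j _ _ = inj₁ (initialUnion-strictMono i<j)
    ... | tri≈ _ i≡j _ = contradiction i≡j i≢j
    ... | tri> _ _ j<i = inj₂ (initialUnion-strictMono j<i)

  clique⇒⋃M-nonTrivial : .{{NonZero n}} → HasClique S p n → NonTrivial S p ⋃M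
  clique⇒⋃M-nonTrivial (V , V-vertex , V-comparable) ⋃M=S =
    ¬¬-sequence (λ i → ¬¬-decidable (Contains (V i))) λ V? →
    1+n≰n (m≤pred[n]⇒suc[m]≤n (chain-length≤ {_≺_ = _⊊_} V V-comparable (λ i → size (V? i))
      (λ i j Vi⊊Vj → size-strictMono (V? i) (V? j) (V-ideal j) Vi⊊Vj λ {x} _ → inj₂ (⋃M=S x))
      (λ i → let (x , x∈Vi) = nonEmpty (V-ideal i) in size-positive (V? i) (V-ideal i) x∈Vi (⋃M=S x))
      (λ i → <⇒≤pred (size<n (V? i) λ ⋃M⊆Vi → proj₂ (V-vertex i) (⋃M⊆Vi ∘ ⋃M=S)))))
    where
    V-ideal : ∀ i → IsLeftIdeal S p (V i)
    V-ideal = proj₁ ∘ V-vertex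

  cliqueBound⇒⋃M-maximal : (∀ k → HasClique S p k → k ≤ n) →
    ∀ J → IsLeftIdeal S p J → NonTrivial S p J → ¬ (⋃M ⊊ J)
  cliqueBound⇒⋃M-maximal cliqueBound J J-ideal J≠S (⋃M⊆J , J⊈⋃M) = 1+n≰n (cliqueBound (suc n)
    (J Vector.∷ initialUnion , ∷-isClique (J-ideal , J≠S) initialUnion⊊J
      (initialUnions-isClique (⊆-nonTrivial {S = S} ⋃M⊆J J≠S))))
    where
    initialUnion⊊J : ∀ i → initialUnion i ⊊ J
    initialUnion⊊J i = ⋃M⊆J ∘ initialUnion⊆⋃M i , λ J⊆Uᵢ → J⊈⋃M (initialUnion⊆⋃M i ∘ J⊆Uᵢ)

  Position : Subset S p → Set (c ⊔ p)
  Position V = V ⊆ ⋃M ⊎ (V ⊈ ⋃M × (∀ x → x ∈ V ∪ ⋃M))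

  ¬¬-position : {V : Subset S p} → IsMaximalLeftIdeal S p ⋃M → IsLeftIdeal S p V → ¬ ¬ Position V
  ¬¬-position {V} (⋃M-ideal , _ , maximality) V-ideal ¬position = ¬¬-excluded-middle {A = V ⊆ ⋃M} λ where
    (yes V⊆⋃M) → ¬position (inj₁ V⊆⋃M)
    (no V⊈⋃M) → maximality (V ∪ ⋃M) (∪-isLeftIdeal V-ideal ⋃M-ideal)
      (λ covers → ¬position (inj₂ (V⊈⋃M , covers)))
      (inj₂ , λ V∪⋃M⊆⋃M → V⊈⋃M (V∪⋃M⊆⋃M ∘ inj₁))

  height : {V : Subset S p} → Decidable (Contains V) → Position V → ℕ
  height V? (inj₁ _) = size V?
  height V? (inj₂ _) = suc (size V?)

  height-positive : {V : Subset S p} (V? : Decidable (Contains V)) → IsLeftIdeal S p V →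
    (pos : Position V) → 0 < height V? pos
  height-positive V? V-ideal (inj₁ V⊆⋃M) =
    let (x , x∈V) = nonEmpty V-ideal in size-positive V? V-ideal x∈V (V⊆⋃M x∈V)
  height-positive V? V-ideal (inj₂ _) = s≤s z≤n

  height≤n : {V : Subset S p} (V? : Decidable (Contains V)) → NonTrivial S p V →
    (pos : Position V) → height V? pos ≤ n
  height≤n V? V≠S (inj₁ _) = ∣p∣≤n (toSubset V?)
  height≤n V? V≠S (inj₂ (_ , covers)) = size<n V? λ ⋃M⊆V → V≠S λ x → [ id , ⋃M⊆V ] (covers x)

  height-strictMono : {V W : Subset S p} (V? : Decidable (Contains V)) (W? : Decidable (Contains W)) →
    IsLeftIdeal S p W → V ⊊ W → (posV : Position V) (posW : Position W) →
    height V? posV < height W? posW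
  height-strictMono V? W? W-ideal V⊊W (inj₁ _) (inj₁ W⊆⋃M) =
    size-strictMono V? W? W-ideal V⊊W (inj₂ ∘ W⊆⋃M)
  height-strictMono V? W? W-ideal V⊊W (inj₁ _) (inj₂ _) = s≤s (size-mono V? W? (proj₁ V⊊W))
  height-strictMono V? W? W-ideal V⊊W (inj₂ (V⊈⋃M , _)) (inj₁ W⊆⋃M) =
    contradiction (λ {x} → W⊆⋃M ∘ proj₁ V⊊W {x}) V⊈⋃M
  height-strictMono V? W? W-ideal V⊊W (inj₂ (_ , covers)) (inj₂ _) =
    s≤s (size-strictMono V? W? W-ideal V⊊W λ {x} _ → covers x)

  maximal⇒cliqueBound : {k : ℕ} → IsMaximalLeftIdeal S p ⋃M → HasClique S p k → k ≤ n
  maximal⇒cliqueBound {k} maximal (V , V-vertex , V-comparable) =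
    decidable-stable (k ≤? n) λ k≰n →
    ¬¬-sequence (λ i → ¬¬-decidable (Contains (V i))) λ V? →
    ¬¬-sequence (λ i → ¬¬-position maximal (V-ideal i)) λ pos →
    k≰n (chain-length≤ {_≺_ = _⊊_} V V-comparable (λ i → height (V? i) (pos i))
      (λ i j Vi⊊Vj → height-strictMono (V? i) (V? j) (V-ideal j) Vi⊊Vj (pos i) (pos j))
      (λ i → height-positive (V? i) (V-ideal i) (pos i))
      (λ i → height≤n (V? i) (proj₂ (V-vertex i)) (pos i)))
    where
    V-ideal : ∀ i → IsLeftIdeal S p (V i)
    V-ideal = proj₁ ∘ V-vertex

mainTheorem6 : ∀ {c ℓ} (p : Level) (S : Semigroup c ℓ) (n : ℕ) → .{{_ : NonZero n}} →
    (M : Fin n → Subset S p) → ExactlyMinimalLeftIdeals S p n M →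
    CliqueNumberIs S p n ⇔ IsMaximalLeftIdeal S p (⋃ S p n M)
mainTheorem6 p S (suc m) M minimals = mk⇔
  (λ (clique , cliqueBound) →
     ⋃M-isLeftIdeal zero , clique⇒⋃M-nonTrivial clique , cliqueBound⇒⋃M-maximal cliqueBound)
  (λ maximal → (initialUnion , initialUnions-isClique (proj₁ (proj₂ maximal))) ,
               λ _ → maximal⇒cliqueBound maximal)
  where open MinimalLeftIdeals minimals
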